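{- Let $N$ be a homogeneous network with asymmetric inputs. If $S$ is a subnetwork of $N$, then the fundamental network $\tilde{S}$ is a quotient network of the fundamental network $\tilde{N}$.
   Context: A homogeneous network with asymmetric inputs has a finite cell set $C$, one cell type, $k$ edge types, each cell receiving exactly one edge of each type; it is represented by $\sigma_1,\dots,\sigma_k:C\to C$ (type-$i$ edge into $c$ comes from $\sigma_i(c)$). A network $S$ with cells $C'$ and edges $E'$ is a subnetwork of $N$ (cells $C$, edges $E$) if $C'\subseteq C$, $E'\subseteq E$ and for every $c'\in C'$ every edge $e\in E$ with target $c'$ lies in $E'$ and has source in $C'$; for asymmetric inputs, $\sigma_i(C')\subseteq C'$ and $S$ is represented by $\sigma_i|_{C'}$. $Q$ is a quotient network of $N$ if $Q$ is obtained from $N$ by a balanced coloring, equivalently if there is a surjective network fibration $N\to Q$ (for asymmetric inputs: a cell map $\varphi$ with $\varphi\circ\sigma_i=\sigma^Q_i\circ\varphi$). Networks are identified up to isomorphism. The fundamental network $\tilde{N}$ has as cells the semigroup $\tilde{C}$ of maps $C\to C$ generated under composition by $Id_C,\sigma_1,\dots,\sigma_k$, represented by $\tilde{\sigma}_i(\gamma)=\sigma_i\circ\gamma$. -}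

module Defs where

open import Data.Nat using (ℕ)
open import Data.Fin using (Fin)
open import Data.Fin.Subset using (Subset; _∈_)
open import Data.List using (List; []; _∷_)
open import Data.Product using (Σ; _,_; proj₁; proj₂; ∃; _×_)
open import Relation.Binary.PropositionalEquality using (_≡_; refl; cong; sym; trans)
open import Relation.Binary.Structures using (IsEquivalence)
open import Relation.Binary.Core using (Rel)

-- A homogeneous network with asymmetric inputs and k edge types,
-- presented on a cell type with an equality (setoid), so that cells of a
-- fundamental network (maps C → C) can be compared extensionally.
-- σ i c is the source of the type-i edge into c.
record Network (k : ℕ) : Set₁ where
  field
    Cell   : Set
    _≈_    : Rel Cell _
    isEquiv : IsEquivalence _≈_
    σ      : Fin k → Cell → Cell
    σ-cong : ∀ i {x y} → x ≈ y → σ i x ≈ σ i y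
  open IsEquivalence isEquiv public

finNet : ∀ {k n} → (Fin k → Fin n → Fin n) → Network k
finNet {k} {n} σ = record
  { Cell = Fin n ; _≈_ = _≡_
  ; isEquiv = record { refl = refl ; sym = sym ; trans = trans }
  ; σ = σ ; σ-cong = λ i → cong (σ i) }

Closed : ∀ {k n} → (Fin k → Fin n → Fin n) → Subset n → Set
Closed σ P = ∀ i c → c ∈ P → σ i c ∈ P

subNet : ∀ {k n} (σ : Fin k → Fin n → Fin n) (P : Subset n) → Closed σ P → Network k
subNet {k} {n} σ P cl = record
  { Cell = Σ (Fin n) (λ c → c ∈ P)
  ; _≈_ = λ x y → proj₁ x ≡ proj₁ y
  ; isEquiv = record { refl = refl ; sym = sym ; trans = trans }
  ; σ = λ i x → σ i (proj₁ x) , cl i (proj₁ x) (proj₂ x)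
  ; σ-cong = λ i → cong (σ i) }

module _ {k : ℕ} (N : Network k) where
  open Network N

  evalWord : List (Fin k) → Cell → Cell
  evalWord []      x = x
  evalWord (i ∷ w) x = σ i (evalWord w x)

  Generated : (Cell → Cell) → Set
  Generated γ = Σ (List (Fin k)) (λ w → ∀ x → γ x ≈ evalWord w x)

  fundamental : Network k
  fundamental = record
    { Cell = Σ (Cell → Cell) Generated
    ; _≈_ = λ γ δ → ∀ x → proj₁ γ x ≈ proj₁ δ x
    ; isEquiv = record
        { refl = λ x → Network.refl N
        ; sym = λ p x → Network.sym N (p x)
        ; trans = λ p q x → Network.trans N (p x) (q x) }
    ; σ = λ i γ → (λ x → σ i (proj₁ γ x))
                 , (i ∷ proj₁ (proj₂ γ)) , (λ x → σ-cong i (proj₂ (proj₂ γ) x))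
    ; σ-cong = λ i p x → σ-cong i (p x) }

IsQuotientOf : ∀ {k} → Network k → Network k → Set
IsQuotientOf Q N =
  Σ (N.Cell → Q.Cell) λ φ →
    (∀ {x y} → x N.≈ y → φ x Q.≈ φ y)
    × (∀ i x → φ (N.σ i x) Q.≈ Q.σ i (φ x))
    × (∀ q → ∃ λ x → φ x Q.≈ q)
  where module N = Network N
        module Q = Network Q

-- Restriction γ ↦ γ|C' is the fibration Ñ → S̃: a generated map σ_w sends
-- the closed set C' into itself, its restriction is the same word evaluated
-- in S, restriction commutes with post-composition by σᵢ, and every word of
-- S is the restriction of the same word in N.
module Submission where

open import Defs
open import Data.Nat using (ℕ)
open import Data.Fin using (Fin)
open import Data.Fin.Subset using (Subset)
open import Data.List using (List; []; _∷_)
open import Data.Product using (∃; _,_; proj₁)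
open import Relation.Binary.PropositionalEquality using (_≡_; refl; sym; cong; module ≡-Reasoning)

module _ {k n : ℕ} (σ : Fin k → Fin n → Fin n) (P : Subset n) (cl : Closed σ P) where

  private
    S = subNet σ P cl
    N = finNet σ
    module Ñ = Network (fundamental N)
    module S̃ = Network (fundamental S)

  evalWord-subNet : ∀ w x → proj₁ (evalWord S w x) ≡ evalWord N w (proj₁ x)
  evalWord-subNet []      x = refl
  evalWord-subNet (i ∷ w) x = cong (σ i) (evalWord-subNet w x)

  -- The restriction is built from the word generating γ: that word is what
  -- certifies that γ maps C' into C'.
  restrict : Ñ.Cell → S̃.Cell
  restrict (γ , w , _) = evalWord S w , w , λ _ → refl

  restrict-restricts : ∀ γ x → proj₁ (proj₁ (restrict γ) x) ≡ proj₁ γ (proj₁ x)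
  restrict-restricts (γ , w , γ≡w) x = begin
    proj₁ (evalWord S w x)  ≡⟨ evalWord-subNet w x ⟩
    evalWord N w (proj₁ x)  ≡⟨ sym (γ≡w (proj₁ x)) ⟩
    γ (proj₁ x)             ∎
    where open ≡-Reasoning

  restrict-cong : ∀ {γ δ} → γ Ñ.≈ δ → restrict γ S̃.≈ restrict δ
  restrict-cong {γ} {δ} γ≈δ x = begin
    proj₁ (proj₁ (restrict γ) x)  ≡⟨ restrict-restricts γ x ⟩
    proj₁ γ (proj₁ x)             ≡⟨ γ≈δ (proj₁ x) ⟩
    proj₁ δ (proj₁ x)             ≡⟨ sym (restrict-restricts δ x) ⟩
    proj₁ (proj₁ (restrict δ) x)  ∎
    where open ≡-Reasoning

  restrict-σ : ∀ i γ → restrict (Ñ.σ i γ) S̃.≈ S̃.σ i (restrict γ)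
  restrict-σ i γ x = refl

  restrict-surjective : ∀ β → ∃ λ γ → restrict γ S̃.≈ β
  restrict-surjective (β , w , β≡w) =
    (evalWord N w , w , λ _ → refl) , λ x → sym (β≡w x)

mainTheorem5 : ∀ {k n : ℕ} (σ : Fin k → Fin n → Fin n) (P : Subset n)
               (cl : Closed σ P) →
               IsQuotientOf (fundamental (subNet σ P cl)) (fundamental (finNet σ))
mainTheorem5 σ P cl =
  restrict σ P cl
  , (λ {γ} {δ} → restrict-cong σ P cl {γ} {δ})
  , restrict-σ σ P cl
  , restrict-surjective σ P cl
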